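{- Let $M',n_0\in\mathbb{N}$ and let $\varepsilon,d,\eta,b,\omega,\sigma$ be positive constants with $1/n_0\ll1/M'\ll\varepsilon\ll d\ll\eta\ll1/b$ and $\omega+\sigma\le b$. Suppose $G$ is a graph on $n\ge n_0$ vertices with degree sequence $d_1\le\dots\le d_n$ such that \[d_i\ge\frac{b-\omega-\sigma}{b}n+\frac{\sigma}{\omega}i+\eta n\quad\text{for all }1\le i\le\frac{\omega n}{b}.\] Let $R$ be a reduced graph of $G$ with parameters $\varepsilon$, $d$ and $M'$, and set $k:=|R|$. Then $R$ has degree sequence $d_{R,1}\le\dots\le d_{R,k}$ such that \[d_{R,i}\ge\frac{b-\omega-\sigma}{b}k+\frac{\sigma}{\omega}i+\frac{\eta k}{2}\quad\text{for all }1\le i\le\frac{\omega k}{b}.\]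
   Context: A bipartite graph with classes $A,B$ has density $d(A,B)=e(A,B)/(|A||B|)$; it is $\varepsilon$-regular if for all $X\subseteq A$, $Y\subseteq B$ with $|X|>\varepsilon|A|$, $|Y|>\varepsilon|B|$ we have $|d(X,Y)-d(A,B)|<\varepsilon$. A reduced graph of $G$ with parameters $\varepsilon,d,M'$ is obtained as follows: take a partition $V(G)=V_0\cup V_1\cup\dots\cup V_k$ and a spanning subgraph $G'\subseteq G$ (as guaranteed by the degree form of Szemerédi's Regularity Lemma) such that $k\ge M'$, $|V_0|\le\varepsilon n$, $|V_1|=\dots=|V_k|$, $d_{G'}(x)>d_G(x)-(d+\varepsilon)n$ for every vertex $x$, $G'[V_i]$ has no edges for $i\ge1$, and for all $1\le i\ne j\le k$ the pair $(V_i,V_j)$ in $G'$ is $\varepsilon$-regular with density either $0$ or at least $d$. Then $R$ has vertex set $\{V_1,\dots,V_k\}$, with $V_iV_j$ an edge iff $(V_i,V_j)_{G'}$ is $\varepsilon$-regular of density at least $d$. Degree sequences list vertex degrees in non-decreasing order. The notation $a\ll b$ means the statement holds provided each constant is chosen sufficiently small (or, for $1/n_0,1/M'$, sufficiently small reciprocal) in terms of those to its right.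
   Formalization: The positive constants ε, d, η, b, ω and σ are rational. -}

module Defs where

open import Data.Bool using (Bool; true; false; _∧_; if_then_else_)
open import Data.Nat as ℕ using (ℕ; zero; suc)
open import Data.Nat using () renaming (_≤_ to _≤ℕ_)
import Data.Nat.Properties as ℕP
open import Data.Fin using (Fin; zero; suc)
open import Data.List using (List; []; _∷_; map; allFin)
open import Data.Integer using (+_)
open import Data.Rational using (ℚ; _/_; _÷_; Positive; 0ℚ; _*_; _+_; _-_; _<_; _≤_; ∣_∣)
open import Data.Fin using (_≟_)
open import Data.Sum using (_⊎_)
open import Relation.Nullary.Decidable using (⌊_⌋)
open import Data.Rational.Properties using (pos⇒nonZero)
open import Data.Product using (Σ; _×_; ∃-syntax)
open import Relation.Binary.PropositionalEquality using (_≡_; _≢_)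
import Data.List.Sort

⟦_⟧ : ℕ → ℚ
⟦ n ⟧ = + n / 1

_÷⁺_ : ℚ → (q : ℚ) → .{{_ : Positive q}} → ℚ
(p ÷⁺ q) = (p ÷ q) {{pos⇒nonZero q}}

count : ∀ {n} → (Fin n → Bool) → ℕ
count {zero} p = 0
count {suc n} p = (if p zero then 1 else 0) ℕ.+ count (λ x → p (suc x))

record Graph (n : ℕ) : Set where
  field
    adj   : Fin n → Fin n → Bool
    sym   : ∀ x y → adj x y ≡ adj y x
    irrfl : ∀ x → adj x x ≡ false
open Graph public

deg : ∀ {n} → Graph n → Fin n → ℕ
deg G x = count (adj G x)

open Data.List.Sort ℕP.≤-decTotalOrder using (sort)

degSeq : ∀ {n} → Graph n → List ℕ
degSeq G = sort (map (deg G) (allFin _))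

-- i-th entry (1-indexed) of a list (0 if out of range; only used in range)
nth : List ℕ → ℕ → ℕ
nth [] i = 0
nth (x ∷ xs) zero = 0
nth (x ∷ xs) (suc zero) = x
nth (x ∷ xs) (suc (suc i)) = nth xs (suc i)

dseq : ∀ {n} → Graph n → ℕ → ℕ
dseq G i = nth (degSeq G) i

_⊆G_ : ∀ {n} → Graph n → Graph n → Set
H ⊆G G = ∀ x y → adj H x y ≡ true → adj G x y ≡ true

VSet : ℕ → Set
VSet n = Fin n → Bool

_⊆_ : ∀ {n} → VSet n → VSet n → Set
X ⊆ Y = ∀ x → X x ≡ true → Y x ≡ true

∣_∣ˢ : ∀ {n} → VSet n → ℕ
∣ X ∣ˢ = count X

sumFin : ∀ {m} → (Fin m → ℕ) → ℕ
sumFin {zero} f = 0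
sumFin {suc m} f = f zero ℕ.+ sumFin (λ x → f (suc x))

eH : ∀ {n} → Graph n → VSet n → VSet n → ℕ
eH H X Y = sumFin (λ x → if X x then count (λ y → Y y ∧ adj H x y) else 0)

-- the fraction a / m as a rational (0 if m = 0; only used with m > 0)
frac : ℕ → ℕ → ℚ
frac a zero = 0ℚ
frac a (suc m) = + a / suc m

density : ∀ {n} → Graph n → VSet n → VSet n → ℚ
density H X Y = frac (eH H X Y) (∣ X ∣ˢ ℕ.* ∣ Y ∣ˢ)

IsRegular : ∀ {n} → Graph n → ℚ → VSet n → VSet n → Set
IsRegular {n} H ε A B =
  ∀ (X Y : VSet n) → X ⊆ A → Y ⊆ B →
    ε * ⟦ ∣ A ∣ˢ ⟧ < ⟦ ∣ X ∣ˢ ⟧ → ε * ⟦ ∣ B ∣ˢ ⟧ < ⟦ ∣ Y ∣ˢ ⟧ →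
    ∣ density H X Y - density H A B ∣ < ε

-- the cluster V_i of a partition part : Fin n → Fin (suc k)
-- (V_0 = part⁻¹(0) is the exceptional set, V_1,…,V_k = part⁻¹(suc i))
cluster : ∀ {n k} → (Fin n → Fin (suc k)) → Fin (suc k) → VSet n
cluster part i x = ⌊ part x ≟ i ⌋

-- R (on vertex set Fin k, vertex i standing for cluster V_{i+1}) is a
-- reduced graph of G with parameters ε, d, M'
IsReducedGraph : ∀ {n k} → Graph n → ℚ → ℚ → ℕ → Graph k → Set
IsReducedGraph {n} {k} G ε d M' R =
  Σ (Fin n → Fin (suc k)) λ part → Σ (Graph n) λ G' →
    let V : Fin k → VSet n
        V i = cluster part (suc i)
    in
    (M' ≤ℕ k) ×
    (⟦ ∣ cluster part zero ∣ˢ ⟧ ≤ ε * ⟦ n ⟧) ×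
    (∀ i j → ∣ V i ∣ˢ ≡ ∣ V j ∣ˢ) ×
    (G' ⊆G G) ×
    (∀ x → ⟦ deg G x ⟧ - (d + ε) * ⟦ n ⟧ < ⟦ deg G' x ⟧) ×
    (∀ i x y → V i x ≡ true → V i y ≡ true → adj G' x y ≡ false) ×
    (∀ i j → i ≢ j →
       IsRegular G' ε (V i) (V j) ×
       (density G' (V i) (V j) ≡ 0ℚ ⊎ d ≤ density G' (V i) (V j))) ×
    (∀ i j → (adj R i j ≡ true →
                 i ≢ j × IsRegular G' ε (V i) (V j) × d ≤ density G' (V i) (V j))
           × (i ≢ j × IsRegular G' ε (V i) (V j) × d ≤ density G' (V i) (V j) →
                 adj R i j ≡ true))

DegCond : ∀ {n} → Graph n → (b ω : ℚ) → .{{_ : Positive b}} → .{{_ : Positive ω}} →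
          (σ η : ℚ) → Set
DegCond {n} G b ω σ η =
  ∀ (i : ℕ) → 1 ≤ℕ i → ⟦ i ⟧ ≤ (ω * ⟦ n ⟧) ÷⁺ b →
    ((b - ω - σ) ÷⁺ b) * ⟦ n ⟧ + (σ ÷⁺ ω) * ⟦ i ⟧ + η * ⟦ n ⟧ ≤ ⟦ dseq G i ⟧

module Submission where

-- Let R be a reduced graph of G, with clusters V₁,…,V_k of common size m
-- and exceptional set V₀.  Since |V₀| ≤ εn < n we have m ≥ 1, and
-- n = |V₀| + km.  Fix 1 ≤ i ≤ ωk/b and put D := d_{R,i}.  At least i
-- clusters have R-degree at most D.  A vertex x of a cluster V_j has all
-- its G'-neighbours in V₀ or in clusters adjacent to V_j in R (G' has no
-- edges inside a cluster, and a regular pair of density 0 spans no edge),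
-- so d_{G'}(x) ≤ εn + m·d_R(j) and d_G(x) ≤ (d+2ε)n + m·d_R(j).  Hence at
-- least im vertices of G have degree at most (d+2ε)n + mD, i.e.
-- d_{im} ≤ (d+2ε)n + mD.  As im ≤ ωn/b, the degree condition for G at
-- index im bounds d_{im} from below; dividing by m and using km ≤ n and
-- d + 2ε ≤ η/2 gives the degree condition for R with η/2.

open import Defs hiding (sym)
open import Data.Bool using (Bool; true; false; _∧_; if_then_else_)
open import Data.Bool.Properties using (∧-zeroʳ; ∧-identityʳ)
open import Data.Nat as ℕ using (ℕ; zero; suc; z≤n; s≤s) renaming (_≤_ to _≤ℕ_)
import Data.Nat.Properties as ℕP
open import Algebra.Properties.CommutativeSemigroup ℕP.+-commutativeSemigroup
  using () renaming (interchange to +-interchange)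
open import Data.Nat.ListAction using (sum)
open import Data.Nat.ListAction.Properties using (sum-↭)
import Data.Nat.Coprimality as Coprime
open import Data.Fin using (Fin; zero; suc; _≟_; fromℕ<)
open import Data.List using (List; []; _∷_; map; allFin; tabulate; length)
import Data.List.Properties as ListP
open import Data.List.Relation.Unary.Linked as Linked using (_∷_)
open import Data.List.Relation.Unary.Sorted.TotalOrder ℕP.≤-totalOrder using (Sorted)
open import Data.List.Relation.Binary.Permutation.Propositional using (_↭_)
open import Data.List.Relation.Binary.Permutation.Propositional.Properties using (↭-length; map⁺)
open import Data.List.Sort ℕP.≤-decTotalOrder using (sort; sort-↭; sort-↗)
import Data.Integer as ℤ
import Data.Integer.Properties as ℤP
open import Data.Rational as ℚ using (ℚ; 0ℚ; 1ℚ; mkℚ; 1/_; _≤_; _<_; _+_; _*_; _-_; -_; Positive)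
import Data.Rational.Properties as ℚP
open import Data.Rational.Solver using (module +-*-Solver)
open +-*-Solver using (solve; _:=_; _:+_; _:*_; _:-_)
open import Data.Product using (Σ; _×_; _,_; proj₂)
open import Data.Sum using (_⊎_; inj₁; inj₂)
open import Data.Empty using (⊥-elim)
open import Relation.Nullary using (Dec; yes; no; does)
open import Relation.Nullary.Decidable using (⌊_⌋; dec-true; isYes≗does; from-yes)
open import Relation.Binary.PropositionalEquality
open import Function using (_∘_; id)

[_]ᵇ : Bool → ℕ
[ b ]ᵇ = if b then 1 else 0

count-ext : ∀ {n} (p q : Fin n → Bool) → (∀ x → p x ≡ q x) → count p ≡ count q
count-ext {zero}  p q e = refl
count-ext {suc n} p q e = cong₂ ℕ._+_ (cong [_]ᵇ (e zero)) (count-ext (p ∘ suc) (q ∘ suc) (e ∘ suc))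

count-mono : ∀ {n} (p q : Fin n → Bool) → (∀ x → p x ≡ true → q x ≡ true) → count p ≤ℕ count q
count-mono {zero} p q p⇒q = z≤n
count-mono {suc n} p q p⇒q with p zero in ep | q zero in eq
... | true  | true  = s≤s (count-mono (p ∘ suc) (q ∘ suc) (p⇒q ∘ suc))
... | false | true  = ℕP.m≤n⇒m≤1+n (count-mono (p ∘ suc) (q ∘ suc) (p⇒q ∘ suc))
... | false | false = count-mono (p ∘ suc) (q ∘ suc) (p⇒q ∘ suc)
... | true  | false with () ← trans (sym eq) (p⇒q zero ep)

count-true : ∀ n → count {n} (λ _ → true) ≡ n
count-true zero    = refl
count-true (suc n) = cong suc (count-true n)

count-false : ∀ n → count {n} (λ _ → false) ≡ 0
count-false zero    = refl
count-false (suc n) = count-false n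

count-zero : ∀ {n} (p : Fin n → Bool) → (∀ x → p x ≡ false) → count p ≡ 0
count-zero {n} p never = trans (count-ext p (λ _ → false) never) (count-false n)

count-zero⁻¹ : ∀ {n} (p : Fin n → Bool) → count p ≡ 0 → ∀ x → p x ≡ false
count-zero⁻¹ {suc n} p c x with p zero in e
count-zero⁻¹ {suc n} p c zero    | false = e
count-zero⁻¹ {suc n} p c (suc x) | false = count-zero⁻¹ (p ∘ suc) c x

count-pos : ∀ {n} (p : Fin n → Bool) x → p x ≡ true → 1 ≤ℕ count p
count-pos p x px with count p in c
... | suc _ = s≤s z≤n
... | zero with () ← trans (sym px) (count-zero⁻¹ p c x)

∧-true⇒ʳ : ∀ a b → a ∧ b ≡ true → b ≡ true
∧-true⇒ʳ true true _ = refl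

count-guard : ∀ {n} (b : Bool) (V : Fin n → Bool) →
  count (λ x → b ∧ V x) ≡ (if b then count V else 0)
count-guard     true  V = refl
count-guard {n} false V = count-false n

sumFin-ext : ∀ {n} (f g : Fin n → ℕ) → (∀ x → f x ≡ g x) → sumFin f ≡ sumFin g
sumFin-ext {zero}  f g e = refl
sumFin-ext {suc n} f g e = cong₂ ℕ._+_ (e zero) (sumFin-ext (f ∘ suc) (g ∘ suc) (e ∘ suc))

sumFin-mono : ∀ {n} (f g : Fin n → ℕ) → (∀ x → f x ≤ℕ g x) → sumFin f ≤ℕ sumFin g
sumFin-mono {zero}  f g f≤g = z≤n
sumFin-mono {suc n} f g f≤g = ℕP.+-mono-≤ (f≤g zero) (sumFin-mono (f ∘ suc) (g ∘ suc) (f≤g ∘ suc))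

sumFin-+ : ∀ {n} (f g : Fin n → ℕ) → sumFin (λ x → f x ℕ.+ g x) ≡ sumFin f ℕ.+ sumFin g
sumFin-+ {zero}  f g = refl
sumFin-+ {suc n} f g =
  trans (cong (f zero ℕ.+ g zero ℕ.+_) (sumFin-+ (f ∘ suc) (g ∘ suc)))
        (+-interchange (f zero) (g zero) (sumFin (f ∘ suc)) (sumFin (g ∘ suc)))

sumFin-const : ∀ n m → sumFin {n} (λ _ → m) ≡ n ℕ.* m
sumFin-const zero    m = refl
sumFin-const (suc n) m = cong (m ℕ.+_) (sumFin-const n m)

sumFin-if : ∀ {n} (q : Fin n → Bool) m → sumFin (λ j → if q j then m else 0) ≡ m ℕ.* count q
sumFin-if {zero}  q m = sym (ℕP.*-zeroʳ m)
sumFin-if {suc n} q m with q zero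
... | true  = trans (cong (m ℕ.+_) (sumFin-if (q ∘ suc) m)) (sym (ℕP.*-suc m _))
... | false = sumFin-if (q ∘ suc) m

sumFin-zero : ∀ {n} (f : Fin n → ℕ) → sumFin f ≡ 0 → ∀ x → f x ≡ 0
sumFin-zero {suc n} f s zero    = ℕP.m+n≡0⇒m≡0 (f zero) s
sumFin-zero {suc n} f s (suc x) = sumFin-zero (f ∘ suc) (ℕP.m+n≡0⇒n≡0 (f zero) s) x

count-singleton : ∀ {K} (c : Fin K) → count (λ j → ⌊ c ≟ j ⌋) ≡ 1
count-singleton {suc K} zero    = cong suc (count-false K)
count-singleton {suc K} (suc c) = trans (count-ext _ _ ≟-suc) (count-singleton c)
  where
  ≟-suc : ∀ j → ⌊ suc c ≟ suc j ⌋ ≡ ⌊ c ≟ j ⌋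
  ≟-suc j with c ≟ j
  ... | yes _ = refl
  ... | no  _ = refl

sumFin-indicator : ∀ {K} (b : Bool) (c : Fin K) → sumFin (λ j → [ b ∧ ⌊ c ≟ j ⌋ ]ᵇ) ≡ [ b ]ᵇ
sumFin-indicator {K} true  c = trans (indicators (λ j → ⌊ c ≟ j ⌋)) (count-singleton c)
  where
  indicators : ∀ {K} (f : Fin K → Bool) → sumFin (λ j → [ f j ]ᵇ) ≡ count f
  indicators {zero}  f = refl
  indicators {suc K} f = cong ([ f zero ]ᵇ ℕ.+_) (indicators (f ∘ suc))
sumFin-indicator {K} false c = trans (sumFin-const K 0) (ℕP.*-zeroʳ K)

count-split : ∀ {n K} (p : Fin n → Bool) (part : Fin n → Fin K) →
  count p ≡ sumFin (λ j → count (λ x → p x ∧ ⌊ part x ≟ j ⌋))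
count-split {zero}  {K} p part = sym (trans (sumFin-const K 0) (ℕP.*-zeroʳ K))
count-split {suc n} {K} p part = sym (begin
  sumFin (λ j → [ p zero ∧ ⌊ part zero ≟ j ⌋ ]ᵇ ℕ.+ count (λ x → p (suc x) ∧ ⌊ part (suc x) ≟ j ⌋))
    ≡⟨ sumFin-+ (λ j → [ p zero ∧ ⌊ part zero ≟ j ⌋ ]ᵇ)
                (λ j → count (λ x → p (suc x) ∧ ⌊ part (suc x) ≟ j ⌋)) ⟩
  sumFin (λ j → [ p zero ∧ ⌊ part zero ≟ j ⌋ ]ᵇ) ℕ.+ sumFin (λ j → count (λ x → p (suc x) ∧ ⌊ part (suc x) ≟ j ⌋))
    ≡⟨ cong₂ ℕ._+_ (sumFin-indicator (p zero) (part zero)) (sym (count-split (p ∘ suc) (part ∘ suc))) ⟩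
  [ p zero ]ᵇ ℕ.+ count (p ∘ suc) ∎)
  where open ≡-Reasoning

vertex-count : ∀ {n k} (part : Fin n → Fin (suc k)) m → (∀ j → ∣ cluster part (suc j) ∣ˢ ≡ m) →
  n ≡ ∣ cluster part zero ∣ˢ ℕ.+ k ℕ.* m
vertex-count {n} {k} part m size = begin
  n                                                ≡⟨ count-true n ⟨
  count {n} (λ _ → true)                           ≡⟨ count-split (λ _ → true) part ⟩
  ∣ cluster part zero ∣ˢ ℕ.+ sumFin (λ j → ∣ cluster part (suc j) ∣ˢ)
                                                   ≡⟨ cong (_ ℕ.+_) (sumFin-ext _ (λ _ → m) size) ⟩
  ∣ cluster part zero ∣ˢ ℕ.+ sumFin {k} (λ _ → m)  ≡⟨ cong (_ ℕ.+_) (sumFin-const k m) ⟩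
  ∣ cluster part zero ∣ˢ ℕ.+ k ℕ.* m               ∎
  where open ≡-Reasoning

in-own-cluster : ∀ {n k} (part : Fin n → Fin (suc k)) x → cluster part (part x) x ≡ true
in-own-cluster part x = trans (isYes≗does (part x ≟ part x)) (dec-true (part x ≟ part x) refl)

selected : ∀ {k} → (Fin k → Bool) → Fin (suc k) → Bool
selected q zero    = false
selected q (suc j) = q j

selected-class : ∀ {k} (q : Fin k → Bool) (a c : Fin (suc k)) →
  selected q a ∧ ⌊ a ≟ c ⌋ ≡ selected q c ∧ ⌊ a ≟ c ⌋
selected-class q a c with a ≟ c
... | yes refl = refl
... | no  _    = trans (∧-zeroʳ (selected q a)) (sym (∧-zeroʳ (selected q c)))

count-selected : ∀ {n k} (part : Fin n → Fin (suc k)) (q : Fin k → Bool) m →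
  (∀ j → ∣ cluster part (suc j) ∣ˢ ≡ m) → count (λ x → selected q (part x)) ≡ m ℕ.* count q
count-selected part q m size = begin
  count (λ x → selected q (part x))
    ≡⟨ count-split _ part ⟩
  sumFin (λ c → count (λ x → selected q (part x) ∧ cluster part c x))
    ≡⟨ sumFin-ext _ _ on-class ⟩
  sumFin (λ j → if q j then ∣ cluster part (suc j) ∣ˢ else 0)
    ≡⟨ sumFin-ext _ _ (λ j → cong (if q j then_else 0) (size j)) ⟩
  sumFin (λ j → if q j then m else 0)
    ≡⟨ sumFin-if q m ⟩
  m ℕ.* count q ∎
  where
  open ≡-Reasoning
  on-class : ∀ c → count (λ x → selected q (part x) ∧ cluster part c x)
                   ≡ (if selected q c then ∣ cluster part c ∣ˢ else 0)
  on-class c = trans (count-ext _ _ (λ x → selected-class q (part x) c))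
                     (count-guard (selected q c) (cluster part c))

countL : (ℕ → Bool) → List ℕ → ℕ
countL p xs = sum (map ([_]ᵇ ∘ p) xs)

countL-↭ : ∀ p {xs ys} → xs ↭ ys → countL p xs ≡ countL p ys
countL-↭ p π = sum-↭ (map⁺ ([_]ᵇ ∘ p) π)

countL-tabulate : ∀ p {n} (h : Fin n → ℕ) → countL p (tabulate h) ≡ count (p ∘ h)
countL-tabulate p {zero}  h = refl
countL-tabulate p {suc n} h = cong ([ p (h zero) ]ᵇ ℕ.+_) (countL-tabulate p (h ∘ suc))

sortedValues : ∀ {n} → (Fin n → ℕ) → List ℕ
sortedValues h = sort (map h (allFin _))

sortedValues-length : ∀ {n} (h : Fin n → ℕ) → length (sortedValues h) ≡ n
sortedValues-length h = trans (↭-length (sort-↭ _))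
  (trans (cong length (ListP.map-tabulate id h)) (ListP.length-tabulate h))

countL-sortedValues : ∀ p {n} (h : Fin n → ℕ) → countL p (sortedValues h) ≡ count (p ∘ h)
countL-sortedValues p h = trans (countL-↭ p (sort-↭ _))
  (trans (cong (countL p) (ListP.map-tabulate id h)) (countL-tabulate p h))

DownClosed : (ℕ → Bool) → Set
DownClosed p = ∀ {x y} → x ≤ℕ y → p y ≡ true → p x ≡ true

sorted-head : ∀ p → DownClosed p → ∀ x xs → Sorted (x ∷ xs) → 1 ≤ℕ countL p (x ∷ xs) → p x ≡ true
sorted-head p down x xs s c with p x in px
... | true = refl
sorted-head p down x []       s        () | false
sorted-head p down x (y ∷ ys) (x≤y ∷ s) c | false = trans (sym px) (down x≤y (sorted-head p down y ys s c))

countL-tail : ∀ b {j a} → suc (suc j) ≤ℕ [ b ]ᵇ ℕ.+ a → suc j ≤ℕ a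
countL-tail true  (s≤s le) = le
countL-tail false le       = ℕP.≤-trans (ℕP.n≤1+n _) le

sorted-nth : ∀ p → DownClosed p → ∀ xs j → Sorted xs → 1 ≤ℕ j → j ≤ℕ countL p xs → p (nth xs j) ≡ true
sorted-nth p down (x ∷ xs)     (suc zero)    s         _ c = sorted-head p down x xs s c
sorted-nth p down (x ∷ [])     (suc (suc j)) s         _ c with () ← countL-tail (p x) c
sorted-nth p down (x ∷ y ∷ ys) (suc (suc j)) (_ ∷ s) _ c =
  sorted-nth p down (y ∷ ys) (suc j) s (s≤s z≤n) (countL-tail (p x) c)

sorted-head-≤ : ∀ x xs i → Sorted (x ∷ xs) → 1 ≤ℕ i → i ≤ℕ length xs → x ≤ℕ nth xs i
sorted-head-≤ x (y ∷ ys)     (suc zero)    (x≤y ∷ s) _ _        = x≤y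
sorted-head-≤ x (y ∷ z ∷ zs) (suc (suc i)) (x≤y ∷ s) _ (s≤s le) =
  ℕP.≤-trans x≤y (sorted-head-≤ y (z ∷ zs) (suc i) s (s≤s z≤n) le)

atMost : ℕ → ℕ → Bool
atMost t y = does (y ℕ.≤? t)

does-true⇒ : ∀ {A : Set} (a? : Dec A) → does a? ≡ true → A
does-true⇒ (yes a) _ = a

sorted-rank : ∀ xs i → Sorted xs → 1 ≤ℕ i → i ≤ℕ length xs → i ≤ℕ countL (atMost (nth xs i)) xs
sorted-rank (x ∷ xs) (suc zero) s _ _ rewrite dec-true (x ℕ.≤? x) ℕP.≤-refl = s≤s z≤n
sorted-rank (x ∷ y ∷ ys) (suc (suc i)) s _ (s≤s le)
  rewrite dec-true (x ℕ.≤? nth (y ∷ ys) (suc i)) (sorted-head-≤ x (y ∷ ys) (suc i) s (s≤s z≤n) le) =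
  s≤s (sorted-rank (y ∷ ys) (suc i) (Linked.tail s) (s≤s z≤n) le)

nth-sortedValues-upper : ∀ {n} (h : Fin n → ℕ) p → DownClosed p → ∀ j → 1 ≤ℕ j →
  j ≤ℕ count (p ∘ h) → p (nth (sortedValues h) j) ≡ true
nth-sortedValues-upper h p down j 1≤j many =
  sorted-nth p down _ j (sort-↗ _) 1≤j (subst (j ≤ℕ_) (sym (countL-sortedValues p h)) many)

nth-sortedValues-rank : ∀ {n} (h : Fin n → ℕ) i → 1 ≤ℕ i → i ≤ℕ n →
  i ≤ℕ count (atMost (nth (sortedValues h) i) ∘ h)
nth-sortedValues-rank h i 1≤i i≤n =
  subst (i ≤ℕ_) (countL-sortedValues _ h)
    (sorted-rank _ i (sort-↗ _) 1≤i (subst (i ≤ℕ_) (sym (sortedValues-length h)) i≤n))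

⟦⟧-as-mkℚ : ∀ n → ⟦ n ⟧ ≡ mkℚ (ℤ.+ n) 0 (Coprime.sym (Coprime.1-coprimeTo n))
⟦⟧-as-mkℚ n = ℚP.normalize-coprime {n} {0} (Coprime.sym (Coprime.1-coprimeTo n))

⟦⟧-+ : ∀ a b → ⟦ a ℕ.+ b ⟧ ≡ ⟦ a ⟧ + ⟦ b ⟧
⟦⟧-+ a b rewrite ⟦⟧-as-mkℚ a | ⟦⟧-as-mkℚ b =
  sym (cong₂ (λ x y → (x ℤ.+ y) ℚ./ 1) (ℤP.*-identityʳ (ℤ.+ a)) (ℤP.*-identityʳ (ℤ.+ b)))

⟦⟧-* : ∀ a b → ⟦ a ℕ.* b ⟧ ≡ ⟦ a ⟧ * ⟦ b ⟧
⟦⟧-* a b rewrite ⟦⟧-as-mkℚ a | ⟦⟧-as-mkℚ b = cong (ℚ._/ 1) (ℤP.pos-* a b)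

⟦⟧-mono : ∀ {a b} → a ≤ℕ b → ⟦ a ⟧ ≤ ⟦ b ⟧
⟦⟧-mono {a} {b} a≤b rewrite ⟦⟧-as-mkℚ a | ⟦⟧-as-mkℚ b =
  ℚ.*≤* (ℤP.*-monoʳ-≤-nonNeg (ℤ.+ 1) (ℤ.+≤+ a≤b))

⟦⟧-cancel : ∀ {a b} → ⟦ a ⟧ ≤ ⟦ b ⟧ → a ≤ℕ b
⟦⟧-cancel {a} {b} le rewrite ⟦⟧-as-mkℚ a | ⟦⟧-as-mkℚ b with le
... | ℚ.*≤* le′ = ℤP.drop‿+≤+ (subst₂ ℤ._≤_ (ℤP.*-identityʳ (ℤ.+ a)) (ℤP.*-identityʳ (ℤ.+ b)) le′)

⟦⟧-nonNeg : ∀ a → 0ℚ ≤ ⟦ a ⟧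
⟦⟧-nonNeg a = ⟦⟧-mono {0} {a} z≤n

⟦⟧-pos : ∀ a → 1 ≤ℕ a → Positive ⟦ a ⟧
⟦⟧-pos (suc a) _ = ℚP.normalize-pos (suc a) 1

pos⇒0≤ : ∀ p → .{{_ : Positive p}} → 0ℚ ≤ p
pos⇒0≤ p = ℚP.<⇒≤ (ℚP.positive⁻¹ p)

0≤* : ∀ {p q} → 0ℚ ≤ p → 0ℚ ≤ q → 0ℚ ≤ p * q
0≤* {p} {q} 0≤p 0≤q =
  subst (_≤ p * q) (ℚP.*-zeroˡ q) (ℚP.*-monoʳ-≤-nonNeg q {{ℚ.nonNegative 0≤q}} 0≤p)

0≤- : ∀ {p q} → p ≤ q → 0ℚ ≤ q - p
0≤- {p} {q} p≤q = subst (_≤ q - p) (ℚP.+-inverseʳ p) (ℚP.+-monoˡ-≤ (- p) p≤q)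

-- One half; the theorem's η ÷⁺ ⟦ 2 ⟧ is definitionally η * ½.
½ : ℚ
½ = 1/ ⟦ 2 ⟧

halves : ∀ q → q * ½ + q * ½ ≡ q
halves q = trans (sym (ℚP.*-distribˡ-+ q ½ ½)) (ℚP.*-identityʳ q)

halve-mono : ∀ {p q} → p ≤ q → p * ½ ≤ q * ½
halve-mono = ℚP.*-monoʳ-≤-nonNeg ½

<-+-≤ : ∀ p q r t → p - q < r → r ≤ t → p ≤ q + t
<-+-≤ p q r t p-q<r r≤t = begin
  p           ≡⟨ solve 2 (λ p q → p := (p :- q) :+ q) refl p q ⟩
  (p - q) + q ≤⟨ ℚP.+-monoˡ-≤ q (ℚP.≤-trans (ℚP.<⇒≤ p-q<r) r≤t) ⟩
  t + q       ≡⟨ ℚP.+-comm t q ⟩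
  q + t       ∎
  where open ℚP.≤-Reasoning

index-scale : ∀ (ω c I K M N : ℚ) → 0ℚ ≤ ω → 0ℚ ≤ c → 0ℚ ≤ M →
  I ≤ (ω * K) * c → K * M ≤ N → I * M ≤ (ω * N) * c
index-scale ω c I K M N 0≤ω 0≤c 0≤M I≤ KM≤N = begin
  I * M             ≤⟨ ℚP.*-monoʳ-≤-nonNeg M {{ℚ.nonNegative 0≤M}} I≤ ⟩
  ((ω * K) * c) * M ≡⟨ solve 4 (λ ω K c M → ((ω :* K) :* c) :* M := (ω :* (K :* M)) :* c) refl ω K c M ⟩
  (ω * (K * M)) * c ≤⟨ ℚP.*-monoʳ-≤-nonNeg c {{ℚ.nonNegative 0≤c}}
                         (ℚP.*-monoˡ-≤-nonNeg ω {{ℚ.nonNegative 0≤ω}} KM≤N) ⟩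
  (ω * N) * c       ∎
  where open ℚP.≤-Reasoning

-- Dividing the estimate for G at index i·m by the cluster size m = M: with
-- K·M ≤ N and e ≤ h, the bounds A·N + s·(I·M) + (h+h)·N ≤ Y ≤ e·N + M·X give
-- A·K + s·I + h·K ≤ X.
scale-down : ∀ (A s h e N M K I X Y : ℚ) → .{{_ : Positive M}} →
  0ℚ ≤ A → 0ℚ ≤ h → 0ℚ ≤ N → K * M ≤ N → e ≤ h →
  A * N + s * (I * M) + (h + h) * N ≤ Y → Y ≤ e * N + M * X →
  A * K + s * I + h * K ≤ X
scale-down A s h e N M K I X Y 0≤A 0≤h 0≤N KM≤N e≤h lower upper = ℚP.*-cancelˡ-≤-pos M (begin
  M * (A * K + s * I + h * K)
    ≡⟨ solve 6 (λ M A K s I h → M :* (A :* K :+ s :* I :+ h :* K)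
                              := A :* (K :* M) :+ s :* (I :* M) :+ h :* (K :* M)) refl M A K s I h ⟩
  A * (K * M) + s * (I * M) + h * (K * M)
    ≤⟨ ℚP.+-mono-≤ (ℚP.+-monoˡ-≤ (s * (I * M)) (ℚP.*-monoˡ-≤-nonNeg A {{ℚ.nonNegative 0≤A}} KM≤N))
                   (ℚP.*-monoˡ-≤-nonNeg h {{ℚ.nonNegative 0≤h}} KM≤N) ⟩
  A * N + s * (I * M) + h * N
    ≡⟨ solve 5 (λ A N s IM h → A :* N :+ s :* IM :+ h :* N
                             := (A :* N :+ s :* IM :+ (h :+ h) :* N) :- h :* N) refl A N s (I * M) h ⟩
  (A * N + s * (I * M) + (h + h) * N) - h * N
    ≤⟨ ℚP.+-monoˡ-≤ (- (h * N)) (ℚP.≤-trans lower upper) ⟩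
  (e * N + M * X) - h * N
    ≤⟨ ℚP.+-monoˡ-≤ (- (h * N)) (ℚP.+-monoˡ-≤ (M * X) (ℚP.*-monoʳ-≤-nonNeg N {{ℚ.nonNegative 0≤N}} e≤h)) ⟩
  (h * N + M * X) - h * N
    ≡⟨ solve 3 (λ h N MX → (h :* N :+ MX) :- h :* N := MX) refl h N (M * X) ⟩
  M * X ∎)
  where open ℚP.≤-Reasoning

frac-zero : ∀ a c → 1 ≤ℕ c → frac a c ≡ 0ℚ → a ≡ 0
frac-zero zero    (suc c) _ _ = refl
frac-zero (suc a) (suc c) _ e = ⊥-elim (ℚP.<-irrefl (sym e)
  (ℚP.positive⁻¹ _ {{ℚP.normalize-pos (suc a) (suc c)}}))

density-zero⇒no-edge : ∀ {n} (H : Graph n) (A B : VSet n) x y → A x ≡ true → B y ≡ true →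
  density H A B ≡ 0ℚ → adj H x y ≡ false
density-zero⇒no-edge H A B x y x∈A y∈B zero-density =
  subst (λ b → b ∧ adj H x y ≡ false) y∈B (count-zero⁻¹ _ no-neighbour-in-B y)
  where
  no-edges : eH H A B ≡ 0
  no-edges = frac-zero _ _ (ℕP.*-mono-≤ (count-pos A x x∈A) (count-pos B y y∈B)) zero-density
  no-neighbour-in-B : count (λ z → B z ∧ adj H x z) ≡ 0
  no-neighbour-in-B = subst (λ b → (if b then count (λ z → B z ∧ adj H x z) else 0) ≡ 0) x∈A
                            (sumFin-zero _ no-edges x)

record Reduction {n k : ℕ} (G : Graph n) (ε d : ℚ) (R : Graph k) : Set where
  field
    part : Fin n → Fin (suc k)
    G′   : Graph n
    exceptional-small    : ⟦ ∣ cluster part zero ∣ˢ ⟧ ≤ ε * ⟦ n ⟧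
    equal-sizes          : ∀ i j → ∣ cluster part (suc i) ∣ˢ ≡ ∣ cluster part (suc j) ∣ˢ
    G′-degrees           : ∀ x → ⟦ deg G x ⟧ - (d + ε) * ⟦ n ⟧ < ⟦ deg G′ x ⟧
    clusters-independent : ∀ i x y → cluster part (suc i) x ≡ true → cluster part (suc i) y ≡ true →
                           adj G′ x y ≡ false
    regular-pairs        : ∀ i j → i ≢ j →
                           IsRegular G′ ε (cluster part (suc i)) (cluster part (suc j)) ×
                           (density G′ (cluster part (suc i)) (cluster part (suc j)) ≡ 0ℚ ⊎
                            d ≤ density G′ (cluster part (suc i)) (cluster part (suc j)))
    R-edges              : ∀ i j → i ≢ j × IsRegular G′ ε (cluster part (suc i)) (cluster part (suc j)) ×
                           d ≤ density G′ (cluster part (suc i)) (cluster part (suc j)) → adj R i j ≡ true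

reduction : ∀ {n k} {G : Graph n} {ε d : ℚ} {M' : ℕ} {R : Graph k} →
  IsReducedGraph G ε d M' R → Reduction G ε d R
reduction (part , G′ , _ , small , equal , _ , degrees , independent , pairs , edges) = record
  { part = part ; G′ = G′ ; exceptional-small = small ; equal-sizes = equal ; G′-degrees = degrees
  ; clusters-independent = independent ; regular-pairs = pairs ; R-edges = λ i j → proj₂ (edges i j) }

module ReducedGraph {n k : ℕ} {G : Graph n} {ε d : ℚ} {R : Graph k} (red : Reduction G ε d R) where
  open Reduction red public

  V₀ : VSet n
  V₀ = cluster part zero

  V : Fin k → VSet n
  V j = cluster part (suc j)

  edges-follow-R : ∀ i j x y → V i x ≡ true → V j y ≡ true → adj R i j ≡ false → adj G′ x y ≡ false
  edges-follow-R i j x y x∈Vi y∈Vj non-edge with i ≟ j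
  ... | yes refl = clusters-independent i x y x∈Vi y∈Vj
  ... | no  i≢j  with regular-pairs i j i≢j
  ...   | _   , inj₁ zero-density = density-zero⇒no-edge G′ (V i) (V j) x y x∈Vi y∈Vj zero-density
  ...   | reg , inj₂ dense with () ← trans (sym non-edge) (R-edges i j (i≢j , reg , dense))

  module Sized (j₀ : Fin k) where

    m : ℕ
    m = ∣ V j₀ ∣ˢ

    N M : ℚ
    N = ⟦ n ⟧
    M = ⟦ m ⟧

    size : ∀ j → ∣ V j ∣ˢ ≡ m
    size j = equal-sizes j j₀

    clusters-fit : k ℕ.* m ≤ℕ n
    clusters-fit = subst (k ℕ.* m ≤ℕ_) (sym (vertex-count part m size)) (ℕP.m≤n+m _ _)

    -- Clusters are non-empty, as |V₀| ≤ εn < n.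
    cluster-nonempty : 1 ≤ℕ n → ε < 1ℚ → 1 ≤ℕ m
    cluster-nonempty 1≤n ε<1 = ℕP.n≢0⇒n>0 m≢0
      where
      m≢0 : m ≢ 0
      m≢0 m≡0 = ℚP.<-irrefl refl (ℚP.≤-<-trans N≤εN εN<N)
        where
        n≡|V₀| : n ≡ ∣ V₀ ∣ˢ
        n≡|V₀| = begin
          n                           ≡⟨ vertex-count part m size ⟩
          ∣ V₀ ∣ˢ ℕ.+ k ℕ.* m         ≡⟨ cong (λ z → ∣ V₀ ∣ˢ ℕ.+ k ℕ.* z) m≡0 ⟩
          ∣ V₀ ∣ˢ ℕ.+ k ℕ.* 0         ≡⟨ cong (∣ V₀ ∣ˢ ℕ.+_) (ℕP.*-zeroʳ k) ⟩
          ∣ V₀ ∣ˢ ℕ.+ 0               ≡⟨ ℕP.+-identityʳ _ ⟩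
          ∣ V₀ ∣ˢ                     ∎
          where open ≡-Reasoning
        N≤εN : N ≤ ε * N
        N≤εN = subst (λ z → ⟦ z ⟧ ≤ ε * N) (sym n≡|V₀|) exceptional-small
        εN<N : ε * N < N
        εN<N = subst (ε * N <_) (ℚP.*-identityˡ N) (ℚP.*-monoˡ-<-pos N {{⟦⟧-pos n 1≤n}} ε<1)

    neighbours-in-cluster : ∀ j i x → V j x ≡ true →
      count (λ y → adj G′ x y ∧ V i y) ≤ℕ (if adj R j i then m else 0)
    neighbours-in-cluster j i x x∈Vj with adj R j i in ji
    ... | true  = subst (_ ≤ℕ_) (size i) (count-mono _ (V i) (λ y → ∧-true⇒ʳ (adj G′ x y) (V i y)))
    ... | false = ℕP.≤-reflexive (count-zero _ no-neighbour)
      where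
      no-neighbour : ∀ y → adj G′ x y ∧ V i y ≡ false
      no-neighbour y with V i y in y∈Vi
      ... | true  = trans (∧-identityʳ _) (edges-follow-R j i x y x∈Vj y∈Vi ji)
      ... | false = ∧-zeroʳ _

    degree-bound : ∀ j x → part x ≡ suc j → deg G′ x ≤ℕ ∣ V₀ ∣ˢ ℕ.+ m ℕ.* deg R j
    degree-bound j x x∈Vj = begin
      deg G′ x
        ≡⟨ count-split (adj G′ x) part ⟩
      count (λ y → adj G′ x y ∧ V₀ y) ℕ.+ sumFin (λ i → count (λ y → adj G′ x y ∧ V i y))
        ≤⟨ ℕP.+-mono-≤ (count-mono _ V₀ (λ y → ∧-true⇒ʳ (adj G′ x y) (V₀ y)))
                       (sumFin-mono _ _ (λ i → neighbours-in-cluster j i x x∈V)) ⟩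
      ∣ V₀ ∣ˢ ℕ.+ sumFin (λ i → if adj R j i then m else 0)
        ≡⟨ cong (∣ V₀ ∣ˢ ℕ.+_) (sumFin-if (adj R j) m) ⟩
      ∣ V₀ ∣ˢ ℕ.+ m ℕ.* deg R j ∎
      where
      open ℕP.≤-Reasoning
      x∈V : V j x ≡ true
      x∈V = subst (λ c → cluster part c x ≡ true) x∈Vj (in-own-cluster part x)

    cluster-vertex-degree : ∀ D j x → part x ≡ suc j → deg R j ≤ℕ D →
      ⟦ deg G x ⟧ ≤ (d + ε + ε) * N + M * ⟦ D ⟧
    cluster-vertex-degree D j x x∈Vj low = begin
      ⟦ deg G x ⟧
        ≤⟨ <-+-≤ _ _ _ _ (G′-degrees x) G′-bound ⟩
      (d + ε) * N + (ε * N + M * ⟦ D ⟧)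
        ≡⟨ solve 4 (λ d ε N MD → (d :+ ε) :* N :+ (ε :* N :+ MD) := (d :+ ε :+ ε) :* N :+ MD)
                   refl d ε N (M * ⟦ D ⟧) ⟩
      (d + ε + ε) * N + M * ⟦ D ⟧ ∎
      where
      open ℚP.≤-Reasoning
      G′-bound : ⟦ deg G′ x ⟧ ≤ ε * N + M * ⟦ D ⟧
      G′-bound = begin
        ⟦ deg G′ x ⟧                       ≤⟨ ⟦⟧-mono (degree-bound j x x∈Vj) ⟩
        ⟦ ∣ V₀ ∣ˢ ℕ.+ m ℕ.* deg R j ⟧      ≡⟨ trans (⟦⟧-+ ∣ V₀ ∣ˢ _) (cong (⟦ ∣ V₀ ∣ˢ ⟧ +_) (⟦⟧-* m (deg R j))) ⟩
        ⟦ ∣ V₀ ∣ˢ ⟧ + M * ⟦ deg R j ⟧      ≤⟨ ℚP.+-mono-≤ exceptional-small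
                                               (ℚP.*-monoˡ-≤-nonNeg M {{ℚ.nonNegative (⟦⟧-nonNeg m)}} (⟦⟧-mono low)) ⟩
        ε * N + M * ⟦ D ⟧                  ∎

    -- The (i·m)-th smallest degree of G is controlled by the i-th smallest degree of R:
    -- d_{im}(G) ≤ (d+2ε)n + m·d_{R,i}, since the ≥ i clusters of R-degree at most
    -- d_{R,i} contain ≥ im vertices, all of G-degree at most that bound.
    degree-transfer : ∀ i → 1 ≤ℕ i → i ≤ℕ k → 1 ≤ℕ m →
      ⟦ dseq G (i ℕ.* m) ⟧ ≤ (d + ε + ε) * N + M * ⟦ dseq R i ⟧
    degree-transfer i 1≤i i≤k 1≤m =
      does-true⇒ (_ ℚ.≤? T)
        (nth-sortedValues-upper (deg G) below below-down (i ℕ.* m) (ℕP.*-mono-≤ 1≤i 1≤m) many-below)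
      where
      D : ℕ
      D = dseq R i
      T : ℚ
      T = (d + ε + ε) * N + M * ⟦ D ⟧
      below : ℕ → Bool
      below t = does (⟦ t ⟧ ℚ.≤? T)
      below-down : DownClosed below
      below-down x≤y y-below =
        dec-true (_ ℚ.≤? T) (ℚP.≤-trans (⟦⟧-mono x≤y) (does-true⇒ (_ ℚ.≤? T) y-below))
      low : Fin k → Bool
      low j = atMost D (deg R j)
      low-cluster⇒below : ∀ x → selected low (part x) ≡ true → below (deg G x) ≡ true
      low-cluster⇒below x in-low with part x in x∈
      low-cluster⇒below x ()     | zero
      low-cluster⇒below x in-low | suc j =
        dec-true (_ ℚ.≤? T) (cluster-vertex-degree D j x x∈ (does-true⇒ (deg R j ℕ.≤? D) in-low))
      many-below : i ℕ.* m ≤ℕ count (below ∘ deg G)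
      many-below = begin
        i ℕ.* m                             ≡⟨ ℕP.*-comm i m ⟩
        m ℕ.* i                             ≤⟨ ℕP.*-monoʳ-≤ m (nth-sortedValues-rank (deg R) i 1≤i i≤k) ⟩
        m ℕ.* count low                     ≡⟨ count-selected part low m size ⟨
        count (λ x → selected low (part x)) ≤⟨ count-mono _ _ low-cluster⇒below ⟩
        count (below ∘ deg G)               ∎
        where open ℕP.≤-Reasoning

fraction-≤ : ∀ (ω b K : ℚ) .{{_ : Positive b}} → ω ≤ b → 0ℚ ≤ K → (ω * K) ÷⁺ b ≤ K
fraction-≤ ω b K ω≤b 0≤K = begin
  (ω * K) * 1/b ≤⟨ ℚP.*-monoʳ-≤-nonNeg 1/b {{ℚ.nonNegative 0≤1/b}}
                     (ℚP.*-monoʳ-≤-nonNeg K {{ℚ.nonNegative 0≤K}} ω≤b) ⟩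
  (b * K) * 1/b ≡⟨ solve 3 (λ b K c → (b :* K) :* c := K :* (b :* c)) refl b K 1/b ⟩
  K * (b * 1/b) ≡⟨ cong (K *_) (ℚP.*-inverseʳ b {{ℚP.pos⇒nonZero b}}) ⟩
  K * 1ℚ        ≡⟨ ℚP.*-identityʳ K ⟩
  K             ∎
  where
  open ℚP.≤-Reasoning
  1/b : ℚ
  1/b = (1/ b) {{ℚP.pos⇒nonZero b}}
  0≤1/b : 0ℚ ≤ 1/b
  0≤1/b = pos⇒0≤ 1/b {{ℚP.1/pos⇒pos b}}

reduced-degree-condition : ∀ {n k} (b ω σ η d ε : ℚ) →
  .{{_ : Positive b}} → .{{_ : Positive ω}} → .{{_ : Positive σ}} → .{{_ : Positive η}} →
  ω + σ ≤ b → d + ε + ε ≤ η * ½ → ε < 1ℚ → 1 ≤ℕ n →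
  (G : Graph n) (R : Graph k) → Reduction G ε d R →
  DegCond G b ω σ η → DegCond R b ω σ (η ÷⁺ ⟦ 2 ⟧)
reduced-degree-condition {n} {k} b ω σ η d ε ω+σ≤b slack ε<1 1≤n G R red degG i 1≤i i≤ωk/b =
  scale-down A s (η * ½) (d + ε + ε) N M K ⟦ i ⟧ ⟦ dseq R i ⟧ ⟦ dseq G (i ℕ.* m) ⟧ {{⟦⟧-pos m 1≤m}}
    0≤A 0≤η/2 (⟦⟧-nonNeg n) KM≤N slack lower (degree-transfer i 1≤i i≤k 1≤m)
  where
  open ReducedGraph red
  A s 1/b K : ℚ
  A = (b - ω - σ) ÷⁺ b
  s = σ ÷⁺ ω
  1/b = (1/ b) {{ℚP.pos⇒nonZero b}}
  K = ⟦ k ⟧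
  0≤1/b : 0ℚ ≤ 1/b
  0≤1/b = pos⇒0≤ 1/b {{ℚP.1/pos⇒pos b}}
  0≤A : 0ℚ ≤ A
  0≤A = 0≤* (subst (0ℚ ≤_) (solve 3 (λ b ω σ → b :- (ω :+ σ) := b :- ω :- σ) refl b ω σ) (0≤- ω+σ≤b)) 0≤1/b
  0≤η/2 : 0ℚ ≤ η * ½
  0≤η/2 = 0≤* (pos⇒0≤ η) (pos⇒0≤ ½)
  ω≤b : ω ≤ b
  ω≤b = ℚP.≤-trans (subst (_≤ ω + σ) (ℚP.+-identityʳ ω) (ℚP.+-monoʳ-≤ ω (pos⇒0≤ σ))) ω+σ≤b
  i≤k : i ≤ℕ k
  i≤k = ⟦⟧-cancel (ℚP.≤-trans i≤ωk/b (fraction-≤ ω b K ω≤b (⟦⟧-nonNeg k)))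
  open Sized (fromℕ< (ℕP.≤-trans 1≤i i≤k))
  1≤m : 1 ≤ℕ m
  1≤m = cluster-nonempty 1≤n ε<1
  KM≤N : K * M ≤ N
  KM≤N = subst (_≤ N) (⟦⟧-* k m) (⟦⟧-mono clusters-fit)
  im≤ωn/b : ⟦ i ℕ.* m ⟧ ≤ (ω * N) ÷⁺ b
  im≤ωn/b = subst (_≤ (ω * N) ÷⁺ b) (sym (⟦⟧-* i m))
    (index-scale ω 1/b ⟦ i ⟧ K M N (pos⇒0≤ ω) 0≤1/b (⟦⟧-nonNeg m) i≤ωk/b KM≤N)
  lower : A * N + s * (⟦ i ⟧ * M) + (η * ½ + η * ½) * N ≤ ⟦ dseq G (i ℕ.* m) ⟧
  lower = subst₂ (λ IM η′ → A * N + s * IM + η′ * N ≤ ⟦ dseq G (i ℕ.* m) ⟧) (⟦⟧-* i m) (sym (halves η))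
    (degG (i ℕ.* m) (ℕP.*-mono-≤ 1≤i 1≤m) im≤ωn/b)

constants-slack : ∀ {η d ε} → d ≤ η * ½ * ½ → ε ≤ d * ½ → d + ε + ε ≤ η * ½
constants-slack {η} {d} {ε} d≤η/4 ε≤d/2 = begin
  d + ε + ε             ≤⟨ ℚP.+-mono-≤ (ℚP.+-monoʳ-≤ d ε≤d/2) ε≤d/2 ⟩
  d + d * ½ + d * ½     ≡⟨ ℚP.+-assoc d (d * ½) (d * ½) ⟩
  d + (d * ½ + d * ½)   ≡⟨ cong (d +_) (halves d) ⟩
  d + d                 ≤⟨ ℚP.+-mono-≤ d≤η/4 d≤η/4 ⟩
  η * ½ * ½ + η * ½ * ½ ≡⟨ halves (η * ½) ⟩
  η * ½                 ∎
  where open ℚP.≤-Reasoning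

constants-ε<1 : ∀ {η d ε} → η ≤ 1ℚ → d ≤ η * ½ * ½ → ε ≤ d * ½ → ε < 1ℚ
constants-ε<1 {η} {d} {ε} η≤1 d≤η/4 ε≤d/2 = begin-strict
  ε                ≤⟨ ε≤d/2 ⟩
  d * ½            ≤⟨ halve-mono d≤η/4 ⟩
  η * ½ * ½ * ½    ≤⟨ halve-mono (halve-mono (halve-mono η≤1)) ⟩
  1ℚ * ½ * ½ * ½   <⟨ from-yes (1ℚ * ½ * ½ * ½ ℚ.<? 1ℚ) ⟩
  1ℚ               ∎
  where open ℚP.≤-Reasoning

lemma5p3 : (b : ℚ) → .{{_ : Positive b}} →
    Σ ℚ λ η₀ → Positive η₀ × ((η : ℚ) → .{{_ : Positive η}} → η ≤ η₀ →
    Σ ℚ λ d₀ → Positive d₀ × ((d : ℚ) → .{{_ : Positive d}} → d ≤ d₀ →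
    Σ ℚ λ ε₀ → Positive ε₀ × ((ε : ℚ) → .{{_ : Positive ε}} → ε ≤ ε₀ →
    Σ ℕ λ M₀ → (M' : ℕ) → M₀ ≤ℕ M' →
    Σ ℕ λ n₀ → (n : ℕ) → n₀ ≤ℕ n →
    (ω σ : ℚ) → .{{_ : Positive ω}} → .{{_ : Positive σ}} → ω + σ ≤ b →
    (G : Graph n) → DegCond G b ω σ η →
    (k : ℕ) (R : Graph k) → IsReducedGraph G ε d M' R →
    DegCond R b ω σ (η ÷⁺ ⟦ 2 ⟧))))
lemma5p3 b = 1ℚ , _ , λ η η≤1 →
  η * ½ * ½ , ℚP.pos*pos⇒pos (η * ½) {{ℚP.pos*pos⇒pos η ½}} ½ , λ d d≤η/4 →
  d * ½ , ℚP.pos*pos⇒pos d ½ , λ ε ε≤d/2 →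
  0 , λ M' _ → 1 , λ n 1≤n ω σ ω+σ≤b G degG k R reduced →
  reduced-degree-condition b ω σ η d ε ω+σ≤b
    (constants-slack {η} d≤η/4 ε≤d/2) (constants-ε<1 η≤1 d≤η/4 ε≤d/2) 1≤n G R (reduction reduced) degG
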